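{- Let $A$ be an integer weighing matrix whose H-equivalence class $[A]$ is symmetric. (a) The number of SH-equivalence classes of symmetric matrices in $[A]$ is either zero or equal to $|H^1(\mathbb Z/2;\mathrm{Aut}(A))|$. (b) If $\mathrm{Aut}(A)$ is abelian, the number of SH-equivalence classes of symmetric matrices in $[A]$ is zero or a power of $2$.
   Context: An integer weighing matrix is $A\in\mathbb Z^{n\times n}$ with $AA^\top=kI$. $\mathrm{Mon}(n)$: monomial $n\times n$ matrices with entries in $\{0,\pm1\}$. $[A]=\{LAR^\top:L,R\in\mathrm{Mon}(n)\}$; it is symmetric if $A^\top\in[A]$. $\mathrm{Aut}(A)=\{(L,R):LAR^\top=A\}$. Two symmetric matrices $B,C$ are SH-equivalent if $C=MBM^\top$ for some $M\in\mathrm{Mon}(n)$. $\mathrm{TAut}(A)$ is the group of pairs $(L,R)\in\mathrm{Aut}(A)$ and formal triples $(L,R,\top)$ with $LA^\top R^\top=A$, with multiplication given by composition of the operations $X\mapsto LXR^\top$ and $X\mapsto LX^\top R^\top$; it fits in an exact sequence $1\to\mathrm{Aut}(A)\to\mathrm{TAut}(A)\to\mathbb Z/2\to1$. When $[A]$ contains a symmetric matrix this sequence splits, and $\mathbb Z/2$ acts on $\mathrm{Aut}(A)$ by conjugation by the image of $1$ under a splitting; $H^1(\mathbb Z/2;\mathrm{Aut}(A))$ denotes the (non-abelian) first cohomology set for this action, equivalently the set of conjugacy classes (under $\mathrm{TAut}(A)$) of splittings. -}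

module Defs where

open import Data.Nat using (ℕ; zero; suc)
open import Data.Integer using (ℤ; _+_; _*_; -_; 0ℤ; 1ℤ)
open import Data.Fin using (Fin; zero; suc)
import Data.Fin as Fin
open import Data.Bool using (Bool; true; false; if_then_else_)
open import Data.Product using (Σ; ∃; _×_; _,_)
open import Data.Sum using (_⊎_)
open import Relation.Nullary using (¬_; does)
open import Relation.Binary.PropositionalEquality using (_≡_; _≢_)

Mat : ℕ → Set
Mat n = Fin n → Fin n → ℤ

infix 4 _≈M_
_≈M_ : ∀ {n} → Mat n → Mat n → Set
A ≈M B = ∀ i j → A i j ≡ B i j

sumFin : ∀ n → (Fin n → ℤ) → ℤ
sumFin zero    f = 0ℤ
sumFin (suc n) f = f zero + sumFin n (λ i → f (suc i))

infixl 7 _⊗_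
_⊗_ : ∀ {n} → Mat n → Mat n → Mat n
_⊗_ {n} A B i j = sumFin n (λ l → A i l * B l j)

_ᵀ : ∀ {n} → Mat n → Mat n
(A ᵀ) i j = A j i

Id : ∀ {n} → Mat n
Id i j = if does (i Fin.≟ j) then 1ℤ else 0ℤ

scal : ∀ {n} → ℤ → Mat n
scal k i j = k * Id i j

IsWeighing : ∀ {n} → Mat n → Set
IsWeighing A = ∃ λ (k : ℤ) → A ⊗ (A ᵀ) ≈M scal k

IsSignEntry : ℤ → Set
IsSignEntry x = x ≡ 0ℤ ⊎ (x ≡ 1ℤ ⊎ x ≡ - 1ℤ)

IsMonomial : ∀ {n} → Mat n → Set
IsMonomial {n} M =
  (∀ i j → IsSignEntry (M i j)) ×
  (∀ i → ∃ λ j → M i j ≢ 0ℤ × (∀ j' → M i j' ≢ 0ℤ → j' ≡ j)) ×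
  (∀ j → ∃ λ i → M i j ≢ 0ℤ × (∀ i' → M i' j ≢ 0ℤ → i' ≡ i))

InClass : ∀ {n} → Mat n → Mat n → Set
InClass A B = ∃ λ L → ∃ λ R → IsMonomial L × IsMonomial R × B ≈M L ⊗ A ⊗ (R ᵀ)

IsSymmetricMat : ∀ {n} → Mat n → Set
IsSymmetricMat B = B ᵀ ≈M B

-- [A] is symmetric: Aᵀ ∈ [A]
ClassSymmetric : ∀ {n} → Mat n → Set
ClassSymmetric A = InClass A (A ᵀ)

SymIn : ∀ {n} → Mat n → Mat n → Set
SymIn A B = InClass A B × IsSymmetricMat B

SHEquiv : ∀ {n} → Mat n → Mat n → Set
SHEquiv B C = ∃ λ M → IsMonomial M × C ≈M M ⊗ B ⊗ (M ᵀ)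

InAut : ∀ {n} → Mat n → Mat n → Mat n → Set
InAut A L R = IsMonomial L × IsMonomial R × L ⊗ A ⊗ (R ᵀ) ≈M A

-- Aut(A) abelian; group law (L,R)(L',R') = (LL', RR')
AutAbelian : ∀ {n} → Mat n → Set
AutAbelian A = ∀ L R L' R' → InAut A L R → InAut A L' R' →
  (L ⊗ L' ≈M L' ⊗ L) × (R ⊗ R' ≈M R' ⊗ R)

-- TAut(A): formal pairs (L,R) (flag false) and triples (L,R,⊤) (flag true)

record TElem (n : ℕ) : Set where
  constructor telem
  field
    tL : Mat n
    tR : Mat n
    tflag : Bool
open TElem public

tact : ∀ {n} → TElem n → Mat n → Mat n
tact (telem L R false) X = L ⊗ X ⊗ (R ᵀ)
tact (telem L R true)  X = L ⊗ (X ᵀ) ⊗ (R ᵀ)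

-- composition g ∘ h (first h, then g), matching composition of the operations
_∘T_ : ∀ {n} → TElem n → TElem n → TElem n
telem L R false ∘T telem L' R' f = telem (L ⊗ L') (R ⊗ R') f
telem L R true  ∘T telem L' R' false = telem (L ⊗ R') (R ⊗ L') true
telem L R true  ∘T telem L' R' true  = telem (L ⊗ R') (R ⊗ L') false

idT : ∀ {n} → TElem n
idT = telem Id Id false

infix 4 _≈T_
_≈T_ : ∀ {n} → TElem n → TElem n → Set
g ≈T h = (tL g ≈M tL h) × (tR g ≈M tR h) × (tflag g ≡ tflag h)

InTAut : ∀ {n} → Mat n → TElem n → Set
InTAut A g = IsMonomial (tL g) × IsMonomial (tR g) × tact g A ≈M A

-- splittings of 1 → Aut(A) → TAut(A) → ℤ/2 → 1 : determined by the image
-- τ of the generator, a transpose-type element of TAut(A) with τ² = 1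
Splitting : ∀ {n} → Mat n → TElem n → Set
Splitting A τ = InTAut A τ × tflag τ ≡ true × (τ ∘T τ) ≈T idT

ConjT : ∀ {n} → Mat n → TElem n → TElem n → Set
ConjT A τ τ' = ∃ λ g → InTAut A g × (g ∘T τ) ≈T (τ' ∘T g)

NumClasses : ∀ {X : Set} → (X → Set) → (X → X → Set) → ℕ → Set
NumClasses {X} P _~_ m =
  Σ (Fin m → X) λ v →
    (∀ i → P (v i)) ×
    (∀ i j → v i ~ v j → i ≡ j) ×
    (∀ x → P x → ∃ λ i → x ~ v i)

module Submission where

-- A splitting of TAut(A) → ℤ/2 is an odd involution τ = (P, Q, ⊤) of TAut(A), so P Q = I and
-- P Aᵀ Qᵀ = A; then Q A is a symmetric matrix in [A]. Every symmetric B = L A Rᵀ in [A] is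
-- SH-equivalent to such a Q A (take Q = Rᵀ L), and two splittings are conjugate in TAut(A)
-- exactly when their matrices Q A are SH-equivalent. So the two counts always agree.
-- If Aut(A), the even part of TAut(A), is abelian, then for a fixed splitting τ₀ the product
-- x ⋆ y = x τ₀ y of splittings descends to conjugacy classes and makes them a finite abelian
-- group of exponent 2 with identity [τ₀]. Such a group has order 2 ^ k, because adjoining an
-- element outside a subgroup doubles its order.

open import Defs
open import Level using (0ℓ)
open import Function using (_∘_; case_of_)
open import Function.Definitions using (Injective)
open import Data.Bool using (Bool; true; false; if_then_else_; _xor_)
open import Data.Nat as ℕ using (ℕ; zero; suc; _^_; _<_)
import Data.Nat.Properties as ℕ
open import Data.Integer as ℤ using (ℤ; _+_; _*_; 0ℤ; 1ℤ)
import Data.Integer.Properties as ℤ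
open import Data.Fin as Fin using (Fin; zero; suc; remQuot; combine)
import Data.Fin.Properties as Fin
open import Data.Product using (Σ; ∃; _×_; _,_; proj₁; proj₂; uncurry)
open import Data.Sum using (_⊎_; inj₁; inj₂; [_,_]′)
open import Relation.Nullary using (yes; no)
open import Relation.Nullary.Decidable using (dec-true; dec-false)
open import Relation.Nullary.Negation using (contradiction)
open import Relation.Binary using (IsEquivalence)
import Relation.Binary.Construct.On as On
open import Relation.Binary.PropositionalEquality using (_≡_; _≢_; refl; sym; trans; cong; cong₂; subst; module ≡-Reasoning)
open import Algebra.Bundles using (Monoid; Group)
import Algebra.Properties.Monoid as MonoidProperties
import Algebra.Properties.Semiring.Sum as SemiringSum
import Algebra.Solver.Monoid as MonoidSolver

module _ {X : Set} {P : X → Set} {_~_ : X → X → Set} (~-isEquivalence : IsEquivalence _~_) where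

  open IsEquivalence ~-isEquivalence using () renaming (sym to ~-sym; trans to ~-trans)

  module Classes {m} (classes : NumClasses P _~_ m) where

    rep : Fin m → X
    rep = proj₁ classes

    rep-P : ∀ i → P (rep i)
    rep-P = proj₁ (proj₂ classes)

    rep-distinct : ∀ i j → rep i ~ rep j → i ≡ j
    rep-distinct = proj₁ (proj₂ (proj₂ classes))

    class : ∀ {x} → P x → Fin m
    class {x} p = proj₁ (proj₂ (proj₂ (proj₂ classes)) x p)

    class-rep : ∀ {x} (p : P x) → x ~ rep (class p)
    class-rep {x} p = proj₂ (proj₂ (proj₂ (proj₂ classes)) x p)

    class-resp : ∀ {x y} (p : P x) (q : P y) → x ~ y → class p ≡ class q
    class-resp p q x~y = rep-distinct _ _ (~-trans (~-sym (class-rep p)) (~-trans x~y (class-rep q)))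

    class-of-rep : ∀ i (p : P (rep i)) → class p ≡ i
    class-of-rep i p = rep-distinct _ _ (~-sym (class-rep p))

  NumClasses-unique : ∀ {m h} → NumClasses P _~_ m → NumClasses P _~_ h → m ≡ h
  NumClasses-unique V W =
    ℕ.≤-antisym (Fin.injective⇒≤ (classify-injective V W)) (Fin.injective⇒≤ (classify-injective W V))
    where
    classify-injective : ∀ {m h} (V : NumClasses P _~_ m) (W : NumClasses P _~_ h) →
                         Injective _≡_ _≡_ (Classes.class W ∘ Classes.rep-P V)
    classify-injective V W {i} {j} same-class = V.rep-distinct i j (~-trans (W.class-rep (V.rep-P i))
      (subst (λ k → W.rep k ~ V.rep j) (sym same-class) (~-sym (W.class-rep (V.rep-P j)))))
      where
      module V = Classes V
      module W = Classes W

record ClassCorrespondence {X Y : Set} (P : X → Set) (_~_ : X → X → Set)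
                           (Q : Y → Set) (_≋_ : Y → Y → Set) : Set where
  field
    image           : Y → X
    image-P         : ∀ y → Q y → P (image y)
    image-preserves : ∀ y y′ → Q y → Q y′ → y ≋ y′ → image y ~ image y′
    image-reflects  : ∀ y y′ → Q y → Q y′ → image y ~ image y′ → y ≋ y′
    image-onto      : ∀ {x} → P x → ∃ λ y → Q y × x ~ image y

NumClasses-transport : ∀ {X Y : Set} {P : X → Set} {_~_ : X → X → Set} {Q : Y → Set} {_≋_ : Y → Y → Set} →
                       IsEquivalence _~_ → ClassCorrespondence P _~_ Q _≋_ →
                       ∀ {m} → NumClasses P _~_ m → NumClasses Q _≋_ m
NumClasses-transport {Y = Y} {_~_ = _~_} {Q} {_≋_} ~-isEquivalence corr V =
  rep′ , rep′-Q , rep′-distinct , rep′-cover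
  where
  open IsEquivalence ~-isEquivalence using () renaming (sym to ~-sym; trans to ~-trans)
  open ClassCorrespondence corr
  open Classes ~-isEquivalence V
  rep′ : _ → Y
  rep′ i = proj₁ (image-onto (rep-P i))
  rep′-Q : ∀ i → Q (rep′ i)
  rep′-Q i = proj₁ (proj₂ (image-onto (rep-P i)))
  rep~image : ∀ i → rep i ~ image (rep′ i)
  rep~image i = proj₂ (proj₂ (image-onto (rep-P i)))
  rep′-distinct : ∀ i j → rep′ i ≋ rep′ j → i ≡ j
  rep′-distinct i j r′i≋r′j = rep-distinct i j (~-trans (rep~image i)
    (~-trans (image-preserves _ _ (rep′-Q i) (rep′-Q j) r′i≋r′j) (~-sym (rep~image j))))
  rep′-cover : ∀ y → Q y → ∃ λ i → y ≋ rep′ i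
  rep′-cover y q = let i = class (image-P y q) in
    i , image-reflects _ _ q (rep′-Q i) (~-trans (class-rep (image-P y q)) (rep~image i))

-- Elementary abelian 2-groups

n<2^n : ∀ n → n < 2 ^ n
n<2^n zero    = ℕ.z<s
n<2^n (suc n) = ℕ.≤-<-trans (n<2^n n) (ℕ.^-monoʳ-< 2 (ℕ.s<s ℕ.z<s) (ℕ.n<1+n n))

module ElementaryAbelian2 {m : ℕ} (_·_ : Fin m → Fin m → Fin m) (e : Fin m)
  (·-assoc : ∀ x y z → (x · y) · z ≡ x · (y · z))
  (·-comm : ∀ x y → x · y ≡ y · x)
  (·-identityˡ : ∀ x → e · x ≡ x)
  (·-self : ∀ x → x · x ≡ e) where

  open ≡-Reasoning

  ·-cancelˡ : ∀ y x → y · (y · x) ≡ x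
  ·-cancelˡ y x = trans (sym (·-assoc y y x)) (trans (cong (_· x) (·-self y)) (·-identityˡ x))

  ·-exchange : ∀ x y z → x · (y · z) ≡ y · (x · z)
  ·-exchange x y z = trans (sym (·-assoc x y z)) (trans (cong (_· z) (·-comm x y)) (·-assoc y x z))

  record Subgroup (k : ℕ) : Set where
    field
      elem           : Fin (2 ^ k) → Fin m
      elem-injective : Injective _≡_ _≡_ elem
      elem-closed    : ∀ i j → ∃ λ l → elem i · elem j ≡ elem l

  trivial : Subgroup 0
  trivial = record
    { elem           = λ _ → e
    ; elem-injective = λ { {zero} {zero} _ → refl }
    ; elem-closed    = λ _ _ → zero , ·-identityˡ e
    }

  translate : Fin m → Fin 2 → Fin m → Fin m
  translate y zero       x = x
  translate y (suc zero) x = y · x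

  translate-· : ∀ y b b′ x x′ → ∃ λ b″ → translate y b x · translate y b′ x′ ≡ translate y b″ (x · x′)
  translate-· y zero       zero       x x′ = zero , refl
  translate-· y zero       (suc zero) x x′ = suc zero , ·-exchange x y x′
  translate-· y (suc zero) zero       x x′ = suc zero , ·-assoc y x x′
  translate-· y (suc zero) (suc zero) x x′ = zero , (begin
    (y · x) · (y · x′)  ≡⟨ ·-assoc y x (y · x′) ⟩
    y · (x · (y · x′))  ≡⟨ cong (y ·_) (·-exchange x y x′) ⟩
    y · (y · (x · x′))  ≡⟨ ·-cancelˡ y (x · x′) ⟩
    x · x′              ∎)

  -- The subgroup H ∪ y H, enumerated through Fin (2 ^ suc k) ≅ Fin 2 × Fin (2 ^ k).
  extend : ∀ {k} (H : Subgroup k) y → (∀ i → Subgroup.elem H i ≢ y) → Subgroup (suc k)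
  extend {k} H y y∉H = record
    { elem           = elem′
    ; elem-injective = elem′-injective
    ; elem-closed    = elem′-closed
    }
    where
    open Subgroup H

    elem′ : Fin (2 ^ suc k) → Fin m
    elem′ = uncurry (λ b j → translate y b (elem j)) ∘ remQuot (2 ^ k)

    y∉H·H : ∀ j j′ → elem j ≢ y · elem j′
    y∉H·H j j′ eq = let l , jj′≡l = elem-closed j j′ in y∉H l (begin
      elem l                    ≡⟨ jj′≡l ⟨
      elem j · elem j′          ≡⟨ cong (_· elem j′) eq ⟩
      (y · elem j′) · elem j′   ≡⟨ ·-assoc y (elem j′) (elem j′) ⟩
      y · (elem j′ · elem j′)   ≡⟨ cong (y ·_) (·-self (elem j′)) ⟩
      y · e                     ≡⟨ ·-comm y e ⟩
      e · y                     ≡⟨ ·-identityˡ y ⟩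
      y                         ∎)

    translate-injective : ∀ b b′ j j′ → translate y b (elem j) ≡ translate y b′ (elem j′) → b ≡ b′ × j ≡ j′
    translate-injective zero       zero       j j′ eq = refl , elem-injective eq
    translate-injective zero       (suc zero) j j′ eq = contradiction eq (y∉H·H j j′)
    translate-injective (suc zero) zero       j j′ eq = contradiction (sym eq) (y∉H·H j′ j)
    translate-injective (suc zero) (suc zero) j j′ eq = refl , elem-injective (begin
      elem j              ≡⟨ ·-cancelˡ y (elem j) ⟨
      y · (y · elem j)    ≡⟨ cong (y ·_) eq ⟩
      y · (y · elem j′)   ≡⟨ ·-cancelˡ y (elem j′) ⟩
      elem j′             ∎)

    elem′-injective : Injective _≡_ _≡_ elem′
    elem′-injective {i} {i′} eq =
      let b , j = remQuot (2 ^ k) i ; b′ , j′ = remQuot (2 ^ k) i′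
          b≡b′ , j≡j′ = translate-injective b b′ j j′ eq
      in begin
      i                                    ≡⟨ Fin.combine-remQuot (2 ^ k) i ⟨
      uncurry combine (remQuot (2 ^ k) i)  ≡⟨ cong₂ combine b≡b′ j≡j′ ⟩
      uncurry combine (remQuot (2 ^ k) i′) ≡⟨ Fin.combine-remQuot (2 ^ k) i′ ⟩
      i′                                   ∎

    elem′-closed : ∀ i i′ → ∃ λ l → elem′ i · elem′ i′ ≡ elem′ l
    elem′-closed i i′ =
      let b , j = remQuot (2 ^ k) i ; b′ , j′ = remQuot (2 ^ k) i′
          b″ , translate-·≡ = translate-· y b b′ (elem j) (elem j′)
          l , jj′≡l = elem-closed j j′
      in combine b″ l , (begin
      elem′ i · elem′ i′               ≡⟨ translate-·≡ ⟩
      translate y b″ (elem j · elem j′) ≡⟨ cong (translate y b″) jj′≡l ⟩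
      translate y b″ (elem l)          ≡⟨ cong (uncurry (λ b j → translate y b (elem j))) (Fin.remQuot-combine b″ l) ⟨
      elem′ (combine b″ l)             ∎)

  order-powerOfTwo : ∃ λ k → m ≡ 2 ^ k
  order-powerOfTwo = grow m trivial refl
    where
    -- Each step adjoins one generator; an injection Fin (2 ^ k) → Fin m forces k < m.
    grow : ∀ fuel {k} → Subgroup k → k ℕ.+ fuel ≡ m → ∃ λ k → m ≡ 2 ^ k
    grow fuel {k} H k+fuel≡m with Fin.all? (λ x → Fin.any? (λ i → Subgroup.elem H i Fin.≟ x))
    ... | yes onto = k , ℕ.≤-antisym (Fin.injective⇒≤ index-injective) (Fin.injective⇒≤ elem-injective)
      where
      open Subgroup H
      index : Fin m → Fin (2 ^ k)
      index x = proj₁ (onto x)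
      index-injective : Injective _≡_ _≡_ index
      index-injective {x} {x′} eq = trans (sym (proj₂ (onto x))) (trans (cong elem eq) (proj₂ (onto x′)))
    ... | no ¬onto with Fin.¬∀⟶∃¬ m _ (λ x → Fin.any? (λ i → Subgroup.elem H i Fin.≟ x)) ¬onto
    ...   | y , y∉H with fuel
    ...     | zero      = contradiction (Fin.injective⇒≤ (Subgroup.elem-injective H))
                            (ℕ.<⇒≱ (subst (_< 2 ^ k) (trans (sym (ℕ.+-identityʳ k)) k+fuel≡m) (n<2^n k)))
    ...     | suc fuel′ = grow fuel′ (extend H y (λ i elem≡y → y∉H (i , elem≡y)))
                            (trans (sym (ℕ.+-suc k fuel′)) k+fuel≡m)

-- Conjugacy classes of odd involutions

module OddInvolutions (G : Group 0ℓ 0ℓ) (parity : Group.Carrier G → Bool)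
  (parity-∙ : ∀ x y → parity (Group._∙_ G x y) ≡ parity x xor parity y) where

  open Group G renaming (refl to ≈-refl; sym to ≈-sym; trans to ≈-trans)
  open MonoidProperties monoid
  open import Relation.Binary.Reasoning.Setoid setoid

  OddInvolution : Carrier → Set
  OddInvolution x = parity x ≡ true × x ∙ x ≈ ε

  Conjugate : Carrier → Carrier → Set
  Conjugate x y = ∃ λ g → g ∙ x ≈ y ∙ g

  ≈⇒Conjugate : ∀ {x y} → x ≈ y → Conjugate x y
  ≈⇒Conjugate {x} {y} x≈y = ε , ≈-trans (identityˡ x) (≈-trans x≈y (≈-sym (identityʳ y)))

  Conjugate-isEquivalence : IsEquivalence Conjugate
  Conjugate-isEquivalence = record
    { refl  = ≈⇒Conjugate ≈-refl
    ; sym   = λ {x} {y} (g , gx≈yg) → g ⁻¹ , (begin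
        g ⁻¹ ∙ y                ≈⟨ insertʳ (inverseʳ g) (g ⁻¹ ∙ y) ⟩
        g ⁻¹ ∙ y ∙ g ∙ g ⁻¹     ≈⟨ ∙-congʳ (assoc (g ⁻¹) y g) ⟩
        g ⁻¹ ∙ (y ∙ g) ∙ g ⁻¹   ≈⟨ ∙-congʳ (∙-congˡ gx≈yg) ⟨
        g ⁻¹ ∙ (g ∙ x) ∙ g ⁻¹   ≈⟨ ∙-congʳ (cancelˡ (inverseˡ g) x) ⟩
        x ∙ g ⁻¹                ∎)
    ; trans = λ {x} {y} {z} (g , gx≈yg) (h , hy≈zh) → h ∙ g , (begin
        h ∙ g ∙ x      ≈⟨ assoc h g x ⟩
        h ∙ (g ∙ x)    ≈⟨ ∙-congˡ gx≈yg ⟩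
        h ∙ (y ∙ g)    ≈⟨ assoc h y g ⟨
        h ∙ y ∙ g      ≈⟨ ∙-congʳ hy≈zh ⟩
        z ∙ h ∙ g      ≈⟨ assoc z h g ⟩
        z ∙ (h ∙ g)    ∎)
    }

  open IsEquivalence Conjugate-isEquivalence using ()
    renaming (sym to Conjugate-sym; trans to Conjugate-trans)

  odd∙odd : ∀ {x y} → parity x ≡ true → parity y ≡ true → parity (x ∙ y) ≡ false
  odd∙odd {x} {y} x-odd y-odd = trans (parity-∙ x y) (cong₂ _xor_ x-odd y-odd)

  -- If g is odd, then g ∙ x is an even element conjugating x to y as well.
  conjugate-by-even : ∀ {x y} → OddInvolution x → Conjugate x y →
                      ∃ λ g → parity g ≡ false × g ∙ x ≈ y ∙ g
  conjugate-by-even {x} {y} (x-odd , xx≈ε) (g , gx≈yg) with parity g in g-parity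
  ... | false = g , g-parity , gx≈yg
  ... | true  = g ∙ x , odd∙odd g-parity x-odd , (begin
    g ∙ x ∙ x      ≈⟨ cancelʳ xx≈ε g ⟩
    g              ≈⟨ cancelʳ xx≈ε g ⟨
    g ∙ x ∙ x      ≈⟨ ∙-congʳ gx≈yg ⟩
    y ∙ g ∙ x      ≈⟨ assoc y g x ⟩
    y ∙ (g ∙ x)    ∎)

  EvenCommutative : Set
  EvenCommutative = ∀ x y → parity x ≡ false → parity y ≡ false → x ∙ y ≈ y ∙ x

  -- (x ⋆ y) ∙ τ = (x ∙ τ) ∙ (y ∙ τ): ⋆ is the product of the even elements x ∙ τ and y ∙ τ.
  module TwistedProduct (even-comm : EvenCommutative) {τ : Carrier} (τ-oddInvolution : OddInvolution τ) where

    private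
      τ-odd = proj₁ τ-oddInvolution
      ττ≈ε = proj₂ τ-oddInvolution

    infixl 7 _⋆_
    _⋆_ : Carrier → Carrier → Carrier
    x ⋆ y = x ∙ τ ∙ y

    ⋆-comm : ∀ {x y} → parity x ≡ true → parity y ≡ true → x ⋆ y ≈ y ⋆ x
    ⋆-comm {x} {y} x-odd y-odd = begin
      x ∙ τ ∙ y                ≈⟨ insertʳ ττ≈ε (x ∙ τ ∙ y) ⟩
      x ∙ τ ∙ y ∙ τ ∙ τ        ≈⟨ ∙-congʳ (assoc (x ∙ τ) y τ) ⟩
      (x ∙ τ) ∙ (y ∙ τ) ∙ τ    ≈⟨ ∙-congʳ (even-comm _ _ (odd∙odd x-odd τ-odd) (odd∙odd y-odd τ-odd)) ⟩
      (y ∙ τ) ∙ (x ∙ τ) ∙ τ    ≈⟨ ∙-congʳ (assoc (y ∙ τ) x τ) ⟨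
      y ∙ τ ∙ x ∙ τ ∙ τ        ≈⟨ cancelʳ ττ≈ε (y ∙ τ ∙ x) ⟩
      y ∙ τ ∙ x                ∎

    ⋆-odd : ∀ {x y} → OddInvolution x → OddInvolution y → OddInvolution (x ⋆ y)
    ⋆-odd {x} {y} (x-odd , xx≈ε) (y-odd , yy≈ε) =
      trans (parity-∙ (x ∙ τ) y) (cong₂ _xor_ (odd∙odd x-odd τ-odd) y-odd) , (begin
      (x ⋆ y) ∙ (x ⋆ y)              ≈⟨ ∙-congˡ (⋆-comm x-odd y-odd) ⟩
      (x ∙ τ ∙ y) ∙ (y ∙ τ ∙ x)      ≈⟨ ∙-congˡ (assoc y τ x) ⟩
      (x ∙ τ ∙ y) ∙ (y ∙ (τ ∙ x))    ≈⟨ cancelᶜ yy≈ε (x ∙ τ) (τ ∙ x) ⟩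
      (x ∙ τ) ∙ (τ ∙ x)              ≈⟨ cancelᶜ ττ≈ε x x ⟩
      x ∙ x                          ≈⟨ xx≈ε ⟩
      ε                              ∎)

    ⋆-assoc : ∀ x y z → x ⋆ y ⋆ z ≈ x ⋆ (y ⋆ z)
    ⋆-assoc x y z = [uv∙w]x≈u[vw∙x] (x ∙ τ) y τ z

    ⋆-identityˡ : ∀ x → τ ⋆ x ≈ x
    ⋆-identityˡ = elimˡ ττ≈ε

    ⋆-self : ∀ {x} → OddInvolution x → Conjugate τ (x ⋆ x)
    ⋆-self {x} (_ , xx≈ε) = x , ≈-sym (cancelʳ xx≈ε (x ∙ τ))

    ⋆-congˡ : ∀ {x x′ y} → OddInvolution x → parity y ≡ true → Conjugate x x′ → Conjugate (x ⋆ y) (x′ ⋆ y)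
    ⋆-congˡ {x} {x′} {y} x-odd y-odd x~x′ =
      let g , g-even , gx≈x′g = conjugate-by-even x-odd x~x′
      in g , (begin
      g ∙ (x ∙ τ ∙ y)      ≈⟨ ∙-congˡ (assoc x τ y) ⟩
      g ∙ (x ∙ (τ ∙ y))    ≈⟨ assoc g x (τ ∙ y) ⟨
      g ∙ x ∙ (τ ∙ y)      ≈⟨ ∙-congʳ gx≈x′g ⟩
      x′ ∙ g ∙ (τ ∙ y)     ≈⟨ assoc x′ g (τ ∙ y) ⟩
      x′ ∙ (g ∙ (τ ∙ y))   ≈⟨ ∙-congˡ (even-comm _ _ g-even (odd∙odd τ-odd y-odd)) ⟩
      x′ ∙ (τ ∙ y ∙ g)     ≈⟨ assoc x′ (τ ∙ y) g ⟨
      x′ ∙ (τ ∙ y) ∙ g     ≈⟨ ∙-congʳ (assoc x′ τ y) ⟨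
      x′ ∙ τ ∙ y ∙ g       ∎)

    ⋆-congʳ : ∀ {x y y′} → OddInvolution x → OddInvolution y → OddInvolution y′ → Conjugate y y′ →
              Conjugate (x ⋆ y) (x ⋆ y′)
    ⋆-congʳ (x-odd , _) y-odd-inv@(y-odd , _) (y′-odd , _) y~y′ =
      Conjugate-trans (≈⇒Conjugate (⋆-comm x-odd y-odd))
        (Conjugate-trans (⋆-congˡ y-odd-inv x-odd y~y′) (≈⇒Conjugate (⋆-comm y′-odd x-odd)))

  oddInvolutionClasses-powerOfTwo : EvenCommutative →
    ∀ m → NumClasses OddInvolution Conjugate m → m ≡ 0 ⊎ ∃ λ k → m ≡ 2 ^ k
  oddInvolutionClasses-powerOfTwo even-comm zero    _       = inj₁ refl
  oddInvolutionClasses-powerOfTwo even-comm (suc m) classes =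
    inj₂ (ElementaryAbelian2.order-powerOfTwo _·_ zero ·-assoc ·-comm ·-identityˡ ·-self)
    where
    open Classes Conjugate-isEquivalence classes
    open TwistedProduct even-comm (rep-P zero)

    _·_ : Fin (suc m) → Fin (suc m) → Fin (suc m)
    i · j = class (⋆-odd (rep-P i) (rep-P j))

    ·-rep : ∀ i j → Conjugate (rep i ⋆ rep j) (rep (i · j))
    ·-rep i j = class-rep (⋆-odd (rep-P i) (rep-P j))

    ·-assoc : ∀ i j k → (i · j) · k ≡ i · (j · k)
    ·-assoc i j k = class-resp _ _
      (Conjugate-trans (⋆-congˡ (rep-P (i · j)) (proj₁ (rep-P k)) (Conjugate-sym (·-rep i j)))
      (Conjugate-trans (≈⇒Conjugate (⋆-assoc (rep i) (rep j) (rep k)))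
                       (⋆-congʳ (rep-P i) (⋆-odd (rep-P j) (rep-P k)) (rep-P (j · k)) (·-rep j k))))

    ·-comm : ∀ i j → i · j ≡ j · i
    ·-comm i j = class-resp _ _ (≈⇒Conjugate (⋆-comm (proj₁ (rep-P i)) (proj₁ (rep-P j))))

    ·-identityˡ : ∀ i → zero · i ≡ i
    ·-identityˡ i = trans (class-resp _ (rep-P i) (≈⇒Conjugate (⋆-identityˡ (rep i)))) (class-of-rep i (rep-P i))

    ·-self : ∀ i → i · i ≡ zero
    ·-self i = trans (class-resp _ (rep-P zero) (Conjugate-sym (⋆-self (rep-P i)))) (class-of-rep zero (rep-P zero))

open SemiringSum ℤ.+-*-semiring using (sum; sum-syntax; ∑-comm; *-distribˡ-sum; *-distribʳ-sum; sum-cong-≗)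

sumFin≡sum : ∀ n (f : Fin n → ℤ) → sumFin n f ≡ sum f
sumFin≡sum zero    f = refl
sumFin≡sum (suc n) f = cong (f zero +_) (sumFin≡sum n (f ∘ suc))

sumFin-cong : ∀ n {f g : Fin n → ℤ} → (∀ i → f i ≡ g i) → sumFin n f ≡ sumFin n g
sumFin-cong zero    f≗g = refl
sumFin-cong (suc n) f≗g = cong₂ _+_ (f≗g zero) (sumFin-cong n (f≗g ∘ suc))

sumFin-zero : ∀ n (f : Fin n → ℤ) → (∀ i → f i ≡ 0ℤ) → sumFin n f ≡ 0ℤ
sumFin-zero zero    f f≡0 = refl
sumFin-zero (suc n) f f≡0 = cong₂ _+_ (f≡0 zero) (sumFin-zero n (f ∘ suc) (f≡0 ∘ suc))

sumFin-single : ∀ n (f : Fin n → ℤ) k → (∀ l → l ≢ k → f l ≡ 0ℤ) → sumFin n f ≡ f k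
sumFin-single (suc n) f zero f≡0 =
  trans (cong (f zero +_) (sumFin-zero n (f ∘ suc) (λ l → f≡0 (suc l) λ ())))
        (ℤ.+-identityʳ (f zero))
sumFin-single (suc n) f (suc k) f≡0 =
  trans (cong (_+ sumFin n (f ∘ suc)) (f≡0 zero λ ()))
        (trans (ℤ.+-identityˡ _)
               (sumFin-single n (f ∘ suc) k (λ l l≢k → f≡0 (suc l) (l≢k ∘ Fin.suc-injective))))

⊗-entry : ∀ {n} (A B : Mat n) i j → (A ⊗ B) i j ≡ ∑[ l < n ] (A i l * B l j)
⊗-entry {n} A B i j = sumFin≡sum n (λ l → A i l * B l j)

module _ {n : ℕ} where

  ≈M-isEquivalence : IsEquivalence (_≈M_ {n})
  ≈M-isEquivalence = record
    { refl  = λ _ _ → refl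
    ; sym   = λ A≈B i j → sym (A≈B i j)
    ; trans = λ A≈B B≈C i j → trans (A≈B i j) (B≈C i j)
    }

  ⊗-cong : {A A′ B B′ : Mat n} → A ≈M A′ → B ≈M B′ → A ⊗ B ≈M A′ ⊗ B′
  ⊗-cong A≈A′ B≈B′ i j = sumFin-cong n (λ l → cong₂ _*_ (A≈A′ i l) (B≈B′ l j))

  ⊗-congˡ : (C : Mat n) {A B : Mat n} → A ≈M B → C ⊗ A ≈M C ⊗ B
  ⊗-congˡ C A≈B = ⊗-cong {C} {C} (λ _ _ → refl) A≈B

  ⊗-congʳ : (C : Mat n) {A B : Mat n} → A ≈M B → A ⊗ C ≈M B ⊗ C
  ⊗-congʳ C {A} {B} A≈B = ⊗-cong {A} {B} {C} {C} A≈B (λ _ _ → refl)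

  ᵀ-cong : {A B : Mat n} → A ≈M B → A ᵀ ≈M B ᵀ
  ᵀ-cong A≈B i j = A≈B j i

  ⊗-ᵀ : (A B : Mat n) → (A ⊗ B) ᵀ ≈M B ᵀ ⊗ A ᵀ
  ⊗-ᵀ A B i j = sumFin-cong n (λ l → ℤ.*-comm (A j l) (B l i))

  ⊗-assoc : (A B C : Mat n) → (A ⊗ B) ⊗ C ≈M A ⊗ (B ⊗ C)
  ⊗-assoc A B C i j = begin
    ((A ⊗ B) ⊗ C) i j
      ≡⟨ ⊗-entry (A ⊗ B) C i j ⟩
    ∑[ l < n ] ((A ⊗ B) i l * C l j)
      ≡⟨ sum-cong-≗ {n} (λ l → cong (_* C l j) (⊗-entry A B i l)) ⟩
    ∑[ l < n ] (∑[ k < n ] (A i k * B k l) * C l j)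
      ≡⟨ sum-cong-≗ {n} (λ l → *-distribʳ-sum {n} (C l j) _) ⟩
    ∑[ l < n ] (∑[ k < n ] (A i k * B k l * C l j))
      ≡⟨ ∑-comm {n} {n} _ ⟩
    ∑[ k < n ] (∑[ l < n ] (A i k * B k l * C l j))
      ≡⟨ sum-cong-≗ {n} (λ k → sum-cong-≗ {n} (λ l → ℤ.*-assoc (A i k) (B k l) (C l j))) ⟩
    ∑[ k < n ] (∑[ l < n ] (A i k * (B k l * C l j)))
      ≡⟨ sum-cong-≗ {n} (λ k → *-distribˡ-sum {n} (A i k) _) ⟨
    ∑[ k < n ] (A i k * ∑[ l < n ] (B k l * C l j))
      ≡⟨ sum-cong-≗ {n} (λ k → cong (A i k *_) (⊗-entry B C k j)) ⟨
    ∑[ k < n ] (A i k * (B ⊗ C) k j)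
      ≡⟨ ⊗-entry A (B ⊗ C) i j ⟨
    (A ⊗ (B ⊗ C)) i j
      ∎
    where open ≡-Reasoning

  Id-diagonal : (i : Fin n) → Id i i ≡ 1ℤ
  Id-diagonal i = cong (if_then 1ℤ else 0ℤ) (dec-true (i Fin.≟ i) refl)

  Id-offDiagonal : {i j : Fin n} → i ≢ j → Id i j ≡ 0ℤ
  Id-offDiagonal {i} {j} i≢j = cong (if_then 1ℤ else 0ℤ) (dec-false (i Fin.≟ j) i≢j)

  Id-ᵀ : Id ᵀ ≈M Id {n}
  Id-ᵀ i j = case i Fin.≟ j of λ where
    (yes refl) → refl
    (no i≢j)   → trans (Id-offDiagonal (i≢j ∘ sym)) (sym (Id-offDiagonal i≢j))

  ⊗-identityˡ : (A : Mat n) → Id ⊗ A ≈M A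
  ⊗-identityˡ A i j = begin
    (Id ⊗ A) i j   ≡⟨ sumFin-single n _ i (λ l l≢i → cong (_* A l j) (Id-offDiagonal (l≢i ∘ sym))) ⟩
    Id i i * A i j ≡⟨ cong (_* A i j) (Id-diagonal i) ⟩
    1ℤ * A i j     ≡⟨ ℤ.*-identityˡ (A i j) ⟩
    A i j          ∎
    where open ≡-Reasoning

  ⊗-identityʳ : (A : Mat n) → A ⊗ Id ≈M A
  ⊗-identityʳ A i j = begin
    (A ⊗ Id) i j   ≡⟨ sumFin-single n _ j (λ l l≢j →
                        trans (cong (A i l *_) (Id-offDiagonal l≢j)) (ℤ.*-zeroʳ (A i l))) ⟩
    A i j * Id j j ≡⟨ cong (A i j *_) (Id-diagonal j) ⟩
    A i j * 1ℤ     ≡⟨ ℤ.*-identityʳ (A i j) ⟩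
    A i j          ∎
    where open ≡-Reasoning

  ⊗-Idᵀ : (A : Mat n) → A ⊗ Id ᵀ ≈M A
  ⊗-Idᵀ A i j = trans (⊗-congˡ A Id-ᵀ i j) (⊗-identityʳ A i j)

Mat-monoid : ℕ → Monoid 0ℓ 0ℓ
Mat-monoid n = record
  { Carrier  = Mat n
  ; _≈_      = _≈M_
  ; _∙_      = _⊗_
  ; ε        = Id
  ; isMonoid = record
    { isSemigroup = record
      { isMagma = record { isEquivalence = ≈M-isEquivalence ; ∙-cong = ⊗-cong }
      ; assoc   = ⊗-assoc
      }
    ; identity = ⊗-identityˡ , ⊗-identityʳ
    }
  }

SignMatrix : ∀ {n} → Mat n → Set
SignMatrix M = ∀ i j → IsSignEntry (M i j)

-- IsMonomial M unfolds to SignMatrix M × RowMonomial M × RowMonomial (M ᵀ).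
RowMonomial : ∀ {n} → Mat n → Set
RowMonomial M = ∀ i → ∃ λ j → M i j ≢ 0ℤ × (∀ j′ → M i j′ ≢ 0ℤ → j′ ≡ j)

sign-* : ∀ {x y} → IsSignEntry x → IsSignEntry y → IsSignEntry (x * y)
sign-* (inj₁ refl)        _                  = inj₁ refl
sign-* {x} _              (inj₁ refl)        = inj₁ (ℤ.*-zeroʳ x)
sign-* (inj₂ (inj₁ refl)) (inj₂ (inj₁ refl)) = inj₂ (inj₁ refl)
sign-* (inj₂ (inj₁ refl)) (inj₂ (inj₂ refl)) = inj₂ (inj₂ refl)
sign-* (inj₂ (inj₂ refl)) (inj₂ (inj₁ refl)) = inj₂ (inj₂ refl)
sign-* (inj₂ (inj₂ refl)) (inj₂ (inj₂ refl)) = inj₂ (inj₁ refl)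

sign-square : ∀ {x} → IsSignEntry x → x ≢ 0ℤ → x * x ≡ 1ℤ
sign-square (inj₁ refl)        x≢0 = contradiction refl x≢0
sign-square (inj₂ (inj₁ refl)) _   = refl
sign-square (inj₂ (inj₂ refl)) _   = refl

*-nonzero : ∀ {x y} → x ≢ 0ℤ → y ≢ 0ℤ → x * y ≢ 0ℤ
*-nonzero {x} x≢0 y≢0 xy≡0 = [ x≢0 , y≢0 ]′ (ℤ.i*j≡0⇒i≡0∨j≡0 x xy≡0)

module Pivot {n} {M : Mat n} (r : RowMonomial M) where

  pivot : Fin n → Fin n
  pivot i = proj₁ (r i)

  pivot-nonzero : ∀ i → M i (pivot i) ≢ 0ℤ
  pivot-nonzero i = proj₁ (proj₂ (r i))

  pivot-unique : ∀ i j → M i j ≢ 0ℤ → j ≡ pivot i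
  pivot-unique i = proj₂ (proj₂ (r i))

  off-pivot : ∀ i j → j ≢ pivot i → M i j ≡ 0ℤ
  off-pivot i j j≢pivot = case M i j ℤ.≟ 0ℤ of λ where
    (yes Mij≡0) → Mij≡0
    (no Mij≢0)  → contradiction (pivot-unique i j Mij≢0) j≢pivot

  ⊗-pivot : (X : Mat n) → ∀ i j → (M ⊗ X) i j ≡ M i (pivot i) * X (pivot i) j
  ⊗-pivot X i j = sumFin-single n _ (pivot i) λ l l≢pivot → cong (_* X l j) (off-pivot i l l≢pivot)

open Pivot

module _ {n : ℕ} where

  private
    module M = Monoid (Mat-monoid n)

  rowMonomial-resp : {M N : Mat n} → M ≈M N → RowMonomial M → RowMonomial N
  rowMonomial-resp M≈N r i =
    let j , Mij≢0 , unique = r i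
    in j , Mij≢0 ∘ trans (M≈N i j) , λ j′ Nij′≢0 → unique j′ (Nij′≢0 ∘ trans (sym (M≈N i j′)))

  rowMonomial-⊗ : {L R : Mat n} → RowMonomial L → RowMonomial R → RowMonomial (L ⊗ R)
  rowMonomial-⊗ {L} {R} rL rR i = pivot rR a , LRij≢0 , unique
    where
    a = pivot rL i
    LRij≢0 : (L ⊗ R) i (pivot rR a) ≢ 0ℤ
    LRij≢0 = subst (_≢ 0ℤ) (sym (⊗-pivot rL R i _)) (*-nonzero (pivot-nonzero rL i) (pivot-nonzero rR a))
    unique : ∀ j → (L ⊗ R) i j ≢ 0ℤ → j ≡ pivot rR a
    unique j LRij≢0 = pivot-unique rR a j λ Raj≡0 →
      LRij≢0 (trans (⊗-pivot rL R i j) (trans (cong (L i a *_) Raj≡0) (ℤ.*-zeroʳ (L i a))))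

  signMatrix-⊗ : {L R : Mat n} → RowMonomial L → SignMatrix L → SignMatrix R → SignMatrix (L ⊗ R)
  signMatrix-⊗ {L} {R} rL sL sR i j =
    subst IsSignEntry (sym (⊗-pivot rL R i j)) (sign-* (sL i (pivot rL i)) (sR (pivot rL i) j))

  monomial-⊗ : {L R : Mat n} → IsMonomial L → IsMonomial R → IsMonomial (L ⊗ R)
  monomial-⊗ {L} {R} (sL , rL , cL) (sR , rR , cR) =
    signMatrix-⊗ rL sL sR , rowMonomial-⊗ rL rR , rowMonomial-resp (M.sym (⊗-ᵀ L R)) (rowMonomial-⊗ cR cL)

  monomial-ᵀ : {M : Mat n} → IsMonomial M → IsMonomial (M ᵀ)
  monomial-ᵀ (s , r , c) = (λ i j → s j i) , c , r

  monomial-Id : IsMonomial (Id {n})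
  monomial-Id = sign , row , rowMonomial-resp (M.sym Id-ᵀ) row
    where
    sign : SignMatrix Id
    sign i j with i Fin.≟ j
    ... | yes _ = inj₂ (inj₁ refl)
    ... | no _  = inj₁ refl
    row : RowMonomial Id
    row i = i , (λ Iii≡0 → contradiction (trans (sym (Id-diagonal i)) Iii≡0) λ ()) ,
      λ j Iij≢0 → case j Fin.≟ i of λ where
        (yes j≡i) → j≡i
        (no j≢i)  → contradiction (Id-offDiagonal (j≢i ∘ sym)) Iij≢0

  monomial-inverseʳ : {M : Mat n} → IsMonomial M → M ⊗ M ᵀ ≈M Id
  monomial-inverseʳ {M} (s , r , c) i j = trans (⊗-pivot r (M ᵀ) i j) (case i Fin.≟ j of λ where
    (yes refl) → trans (sign-square (s i a) (pivot-nonzero r i)) (sym (Id-diagonal i))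
    (no i≢j)   → begin
      M i a * M j a  ≡⟨ cong (M i a *_) (off-pivot c a j (λ j≡i′ → i≢j (trans i≡i′ (sym j≡i′)))) ⟩
      M i a * 0ℤ     ≡⟨ ℤ.*-zeroʳ (M i a) ⟩
      0ℤ             ≡⟨ Id-offDiagonal i≢j ⟨
      Id i j         ∎)
    where
    open ≡-Reasoning
    a = pivot r i
    i≡i′ : i ≡ pivot c a
    i≡i′ = pivot-unique c a i (pivot-nonzero r i)

  monomial-inverseˡ : {M : Mat n} → IsMonomial M → M ᵀ ⊗ M ≈M Id
  monomial-inverseˡ m = monomial-inverseʳ (monomial-ᵀ m)

module _ {n : ℕ} where

  private
    module M = Monoid (Mat-monoid n)
  open MonoidSolver (Mat-monoid n) using (solve; _⊜_; _⊕_)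
  open import Relation.Binary.Reasoning.Setoid M.setoid

  twoSided-∘ : (L R L′ R′ X : Mat n) → L ⊗ (L′ ⊗ X ⊗ R′ ᵀ) ⊗ R ᵀ ≈M (L ⊗ L′) ⊗ X ⊗ (R ⊗ R′) ᵀ
  twoSided-∘ L R L′ R′ X = begin
    L ⊗ (L′ ⊗ X ⊗ R′ ᵀ) ⊗ R ᵀ     ≈⟨ solve 5 (λ a b c d e → (a ⊕ ((b ⊕ c) ⊕ d)) ⊕ e ⊜ ((a ⊕ b) ⊕ c) ⊕ (d ⊕ e))
                                          M.refl L L′ X (R′ ᵀ) (R ᵀ) ⟩
    (L ⊗ L′) ⊗ X ⊗ (R′ ᵀ ⊗ R ᵀ)   ≈⟨ ⊗-congˡ ((L ⊗ L′) ⊗ X) (⊗-ᵀ R R′) ⟨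
    (L ⊗ L′) ⊗ X ⊗ (R ⊗ R′) ᵀ     ∎

  twoSided-ᵀ : (L X R : Mat n) → (L ⊗ X ⊗ R ᵀ) ᵀ ≈M R ⊗ X ᵀ ⊗ L ᵀ
  twoSided-ᵀ L X R = begin
    (L ⊗ X ⊗ R ᵀ) ᵀ      ≈⟨ ⊗-ᵀ (L ⊗ X) (R ᵀ) ⟩
    R ⊗ (L ⊗ X) ᵀ        ≈⟨ ⊗-congˡ R (⊗-ᵀ L X) ⟩
    R ⊗ (X ᵀ ⊗ L ᵀ)      ≈⟨ M.assoc R (X ᵀ) (L ᵀ) ⟨
    R ⊗ X ᵀ ⊗ L ᵀ        ∎

-- The group TAut(A)

IsMonomialT : ∀ {n} → TElem n → Set
IsMonomialT g = IsMonomial (tL g) × IsMonomial (tR g)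

invT : ∀ {n} → TElem n → TElem n
invT (telem L R false) = telem (L ᵀ) (R ᵀ) false
invT (telem L R true)  = telem (R ᵀ) (L ᵀ) true

module _ {n : ℕ} where

  private
    module M = Monoid (Mat-monoid n)
  open import Relation.Binary.Reasoning.Setoid M.setoid

  ≈T-isEquivalence : IsEquivalence (_≈T_ {n})
  ≈T-isEquivalence = record
    { refl  = M.refl , M.refl , refl
    ; sym   = λ (l , r , f) → M.sym l , M.sym r , sym f
    ; trans = λ (l , r , f) (l′ , r′ , f′) → M.trans l l′ , M.trans r r′ , trans f f′
    }

  ∘T-cong : {g g′ h h′ : TElem n} → g ≈T g′ → h ≈T h′ → g ∘T h ≈T g′ ∘T h′
  ∘T-cong {telem _ _ false} {h = telem _ _ _}     (l , r , refl) (l′ , r′ , refl) = ⊗-cong l l′ , ⊗-cong r r′ , refl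
  ∘T-cong {telem _ _ true}  {h = telem _ _ false} (l , r , refl) (l′ , r′ , refl) = ⊗-cong l r′ , ⊗-cong r l′ , refl
  ∘T-cong {telem _ _ true}  {h = telem _ _ true}  (l , r , refl) (l′ , r′ , refl) = ⊗-cong l r′ , ⊗-cong r l′ , refl

  ∘T-assoc : (g h k : TElem n) → (g ∘T h) ∘T k ≈T g ∘T (h ∘T k)
  ∘T-assoc (telem a b false) (telem c d false) (telem e f _)     = M.assoc a c e , M.assoc b d f , refl
  ∘T-assoc (telem a b false) (telem c d true)  (telem e f false) = M.assoc a c f , M.assoc b d e , refl
  ∘T-assoc (telem a b false) (telem c d true)  (telem e f true)  = M.assoc a c f , M.assoc b d e , refl
  ∘T-assoc (telem a b true)  (telem c d false) (telem e f false) = M.assoc a d f , M.assoc b c e , refl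
  ∘T-assoc (telem a b true)  (telem c d false) (telem e f true)  = M.assoc a d f , M.assoc b c e , refl
  ∘T-assoc (telem a b true)  (telem c d true)  (telem e f false) = M.assoc a d e , M.assoc b c f , refl
  ∘T-assoc (telem a b true)  (telem c d true)  (telem e f true)  = M.assoc a d e , M.assoc b c f , refl

  ∘T-identityˡ : (g : TElem n) → idT ∘T g ≈T g
  ∘T-identityˡ (telem L R _) = M.identityˡ L , M.identityˡ R , refl

  ∘T-identityʳ : (g : TElem n) → g ∘T idT ≈T g
  ∘T-identityʳ (telem L R false) = M.identityʳ L , M.identityʳ R , refl
  ∘T-identityʳ (telem L R true)  = M.identityʳ L , M.identityʳ R , refl

  invT-cong : {g h : TElem n} → g ≈T h → invT g ≈T invT h
  invT-cong {telem _ _ false} (l , r , refl) = ᵀ-cong l , ᵀ-cong r , refl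
  invT-cong {telem _ _ true}  (l , r , refl) = ᵀ-cong r , ᵀ-cong l , refl

  invT-inverseˡ : (g : TElem n) → IsMonomialT g → invT g ∘T g ≈T idT
  invT-inverseˡ (telem L R false) (mL , mR) = monomial-inverseˡ mL , monomial-inverseˡ mR , refl
  invT-inverseˡ (telem L R true)  (mL , mR) = monomial-inverseˡ mR , monomial-inverseˡ mL , refl

  invT-inverseʳ : (g : TElem n) → IsMonomialT g → g ∘T invT g ≈T idT
  invT-inverseʳ (telem L R false) (mL , mR) = monomial-inverseʳ mL , monomial-inverseʳ mR , refl
  invT-inverseʳ (telem L R true)  (mL , mR) = monomial-inverseʳ mL , monomial-inverseʳ mR , refl

  monomialT-∘T : (g h : TElem n) → IsMonomialT g → IsMonomialT h → IsMonomialT (g ∘T h)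
  monomialT-∘T (telem _ _ false) (telem _ _ _)     (mL , mR) (mL′ , mR′) = monomial-⊗ mL mL′ , monomial-⊗ mR mR′
  monomialT-∘T (telem _ _ true)  (telem _ _ false) (mL , mR) (mL′ , mR′) = monomial-⊗ mL mR′ , monomial-⊗ mR mL′
  monomialT-∘T (telem _ _ true)  (telem _ _ true)  (mL , mR) (mL′ , mR′) = monomial-⊗ mL mR′ , monomial-⊗ mR mL′

  monomialT-invT : (g : TElem n) → IsMonomialT g → IsMonomialT (invT g)
  monomialT-invT (telem _ _ false) (mL , mR) = monomial-ᵀ mL , monomial-ᵀ mR
  monomialT-invT (telem _ _ true)  (mL , mR) = monomial-ᵀ mR , monomial-ᵀ mL

  tact-cong : {g h : TElem n} {X Y : Mat n} → g ≈T h → X ≈M Y → tact g X ≈M tact h Y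
  tact-cong {telem _ _ false} (l , r , refl) X≈Y = ⊗-cong (⊗-cong l X≈Y) (ᵀ-cong r)
  tact-cong {telem _ _ true}  (l , r , refl) X≈Y = ⊗-cong (⊗-cong l (ᵀ-cong X≈Y)) (ᵀ-cong r)

  tact-∘T : (g h : TElem n) (X : Mat n) → tact (g ∘T h) X ≈M tact g (tact h X)
  tact-∘T (telem L R false) (telem L′ R′ false) X = M.sym (twoSided-∘ L R L′ R′ X)
  tact-∘T (telem L R false) (telem L′ R′ true)  X = M.sym (twoSided-∘ L R L′ R′ (X ᵀ))
  tact-∘T (telem L R true)  (telem L′ R′ false) X = M.sym (begin
    L ⊗ (L′ ⊗ X ⊗ R′ ᵀ) ᵀ ⊗ R ᵀ     ≈⟨ ⊗-congʳ (R ᵀ) (⊗-congˡ L (twoSided-ᵀ L′ X R′)) ⟩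
    L ⊗ (R′ ⊗ X ᵀ ⊗ L′ ᵀ) ⊗ R ᵀ     ≈⟨ twoSided-∘ L R R′ L′ (X ᵀ) ⟩
    (L ⊗ R′) ⊗ X ᵀ ⊗ (R ⊗ L′) ᵀ     ∎)
  tact-∘T (telem L R true)  (telem L′ R′ true)  X = M.sym (begin
    L ⊗ (L′ ⊗ X ᵀ ⊗ R′ ᵀ) ᵀ ⊗ R ᵀ   ≈⟨ ⊗-congʳ (R ᵀ) (⊗-congˡ L (twoSided-ᵀ L′ (X ᵀ) R′)) ⟩
    L ⊗ (R′ ⊗ X ⊗ L′ ᵀ) ⊗ R ᵀ       ≈⟨ twoSided-∘ L R R′ L′ X ⟩
    (L ⊗ R′) ⊗ X ⊗ (R ⊗ L′) ᵀ       ∎)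

  tact-idT : (X : Mat n) → tact idT X ≈M X
  tact-idT X = M.trans (⊗-Idᵀ (Id ⊗ X)) (M.identityˡ X)

module _ {n : ℕ} (A : Mat n) where

  private
    module M = Monoid (Mat-monoid n)
    module ≈T = IsEquivalence (≈T-isEquivalence {n})
  open import Relation.Binary.Reasoning.Setoid M.setoid

  InTAut-∘T : ∀ {g h} → InTAut A g → InTAut A h → InTAut A (g ∘T h)
  InTAut-∘T {g} {h} (mLg , mRg , gA≈A) (mLh , mRh , hA≈A) =
    let mL , mR = monomialT-∘T g h (mLg , mRg) (mLh , mRh) in
    mL , mR , (begin
      tact (g ∘T h) A    ≈⟨ tact-∘T g h A ⟩
      tact g (tact h A)  ≈⟨ tact-cong {g = g} ≈T.refl hA≈A ⟩
      tact g A           ≈⟨ gA≈A ⟩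
      A                  ∎)

  InTAut-invT : ∀ {g} → InTAut A g → InTAut A (invT g)
  InTAut-invT {g} (mL , mR , gA≈A) =
    let mL′ , mR′ = monomialT-invT g (mL , mR) in
    mL′ , mR′ , (begin
      tact (invT g) A           ≈⟨ tact-cong {g = invT g} ≈T.refl gA≈A ⟨
      tact (invT g) (tact g A)  ≈⟨ tact-∘T (invT g) g A ⟨
      tact (invT g ∘T g) A      ≈⟨ tact-cong (invT-inverseˡ g (mL , mR)) M.refl ⟩
      tact idT A                ≈⟨ tact-idT A ⟩
      A                         ∎)

  InTAut-idT : InTAut A idT
  InTAut-idT = monomial-Id , monomial-Id , tact-idT A

  TAut : Group 0ℓ 0ℓ
  TAut = record
    { Carrier = Σ (TElem n) (InTAut A)
    ; _≈_     = λ g h → proj₁ g ≈T proj₁ h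
    ; _∙_     = λ g h → proj₁ g ∘T proj₁ h , InTAut-∘T {proj₁ g} {proj₁ h} (proj₂ g) (proj₂ h)
    ; ε       = idT , InTAut-idT
    ; _⁻¹     = λ g → invT (proj₁ g) , InTAut-invT {proj₁ g} (proj₂ g)
    ; isGroup = record
      { isMonoid = record
        { isSemigroup = record
          { isMagma = record
            { isEquivalence = On.isEquivalence proj₁ ≈T-isEquivalence
            ; ∙-cong        = ∘T-cong
            }
          ; assoc = λ g h k → ∘T-assoc (proj₁ g) (proj₁ h) (proj₁ k)
          }
        ; identity = ∘T-identityˡ ∘ proj₁ , ∘T-identityʳ ∘ proj₁
        }
      ; inverse = (λ (g , mL , mR , _) → invT-inverseˡ g (mL , mR))
                , (λ (g , mL , mR , _) → invT-inverseʳ g (mL , mR))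
      ; ⁻¹-cong = invT-cong
      }
    }

  parity : Σ (TElem n) (InTAut A) → Bool
  parity = tflag ∘ proj₁

  parity-∙ : ∀ g h → parity (Group._∙_ TAut g h) ≡ parity g xor parity h
  parity-∙ (telem _ _ false , _) (telem _ _ _ , _)     = refl
  parity-∙ (telem _ _ true  , _) (telem _ _ false , _) = refl
  parity-∙ (telem _ _ true  , _) (telem _ _ true , _)  = refl

-- Symmetric matrices in [A] and splittings

module _ {n : ℕ} where

  private
    module M = Monoid (Mat-monoid n)
  open MonoidProperties (Mat-monoid n) using (cancelˡ; elimʳ)
  open MonoidSolver (Mat-monoid n) using (solve; _⊜_; _⊕_)
  open import Relation.Binary.Reasoning.Setoid M.setoid

  SHEquiv-isEquivalence : IsEquivalence (SHEquiv {n})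
  SHEquiv-isEquivalence = record
    { refl  = λ {B} → Id , monomial-Id , M.sym (tact-idT B)
    ; sym   = λ {B} {C} (P , mP , C≈PBPᵀ) → P ᵀ , monomial-ᵀ mP , M.sym (begin
        P ᵀ ⊗ C ⊗ P                ≈⟨ ⊗-congʳ P (⊗-congˡ (P ᵀ) C≈PBPᵀ) ⟩
        P ᵀ ⊗ (P ⊗ B ⊗ P ᵀ) ⊗ P    ≈⟨ solve 4 (λ p q b r → (q ⊕ ((p ⊕ b) ⊕ r)) ⊕ p ⊜ (q ⊕ (p ⊕ b)) ⊕ (r ⊕ p))
                                         M.refl P (P ᵀ) B (P ᵀ) ⟩
        P ᵀ ⊗ (P ⊗ B) ⊗ (P ᵀ ⊗ P)  ≈⟨ elimʳ {a = P ᵀ ⊗ P} (monomial-inverseˡ mP) (P ᵀ ⊗ (P ⊗ B)) ⟩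
        P ᵀ ⊗ (P ⊗ B)              ≈⟨ cancelˡ {a = P ᵀ} {c = P} (monomial-inverseˡ mP) B ⟩
        B                          ∎)
    ; trans = λ {B} {C} {D} (P , mP , C≈PBPᵀ) (Q , mQ , D≈QCQᵀ) → Q ⊗ P , monomial-⊗ mQ mP , (begin
        D                          ≈⟨ D≈QCQᵀ ⟩
        Q ⊗ C ⊗ Q ᵀ                ≈⟨ ⊗-congʳ (Q ᵀ) (⊗-congˡ Q C≈PBPᵀ) ⟩
        Q ⊗ (P ⊗ B ⊗ P ᵀ) ⊗ Q ᵀ    ≈⟨ twoSided-∘ Q Q P P B ⟩
        (Q ⊗ P) ⊗ B ⊗ (Q ⊗ P) ᵀ    ∎)
    }

  SHEquiv-symmetric : {B C : Mat n} → IsSymmetricMat B → SHEquiv B C → IsSymmetricMat C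
  SHEquiv-symmetric {B} {C} Bᵀ≈B (P , _ , C≈PBPᵀ) = begin
    C ᵀ                ≈⟨ ᵀ-cong C≈PBPᵀ ⟩
    (P ⊗ B ⊗ P ᵀ) ᵀ    ≈⟨ twoSided-ᵀ P B P ⟩
    P ⊗ B ᵀ ⊗ P ᵀ      ≈⟨ ⊗-congʳ (P ᵀ) (⊗-congˡ P Bᵀ≈B) ⟩
    P ⊗ B ⊗ P ᵀ        ≈⟨ C≈PBPᵀ ⟨
    C                  ∎

module SplittingCorrespondence {n : ℕ} (A : Mat n) where

  open OddInvolutions (TAut A) (parity A) (parity-∙ A) public
  open Group (TAut A) using (Carrier; _∙_; _≈_)
  private
    module M = Monoid (Mat-monoid n)
  open MonoidProperties (Mat-monoid n) using (cancelˡ; cancelʳ; elimʳ; insertˡ)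
  open MonoidSolver (Mat-monoid n) using (solve; _⊜_; _⊕_)
  open import Relation.Binary.Reasoning.Setoid M.setoid

  symmetricOf : Carrier → Mat n
  symmetricOf τ = tR (proj₁ τ) ⊗ A

  symmetricOf-SymIn : ∀ τ → OddInvolution τ → SymIn A (symmetricOf τ)
  symmetricOf-SymIn (telem P Q _ , _ , mQ , PAᵀQᵀ≈A) (refl , _ , QP≈I , _) =
    (Q , Id , mQ , monomial-Id , M.sym (⊗-Idᵀ (Q ⊗ A))) , (begin
      (Q ⊗ A) ᵀ                ≈⟨ ⊗-ᵀ Q A ⟩
      A ᵀ ⊗ Q ᵀ                ≈⟨ insertˡ {a = Q} {c = P} QP≈I (A ᵀ ⊗ Q ᵀ) ⟩
      Q ⊗ (P ⊗ (A ᵀ ⊗ Q ᵀ))    ≈⟨ ⊗-congˡ Q (M.assoc P (A ᵀ) (Q ᵀ)) ⟨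
      Q ⊗ (P ⊗ A ᵀ ⊗ Q ᵀ)      ≈⟨ ⊗-congˡ Q PAᵀQᵀ≈A ⟩
      Q ⊗ A                    ∎)

  symmetricOf-reflects : ∀ τ τ′ → OddInvolution τ → OddInvolution τ′ →
                         SHEquiv (symmetricOf τ) (symmetricOf τ′) → Conjugate τ τ′
  symmetricOf-reflects (telem P Q _ , _ , mQ , _) (telem P′ Q′ _ , mP′ , _)
                       (refl , _ , QP≈I , _) (refl , P′Q′≈I , Q′P′≈I , _) (N , mN , Q′A≈NQANᵀ) =
    (telem (P′ ⊗ N ⊗ Q) N false , monomial-⊗ (monomial-⊗ mP′ mN) mQ , mN , g-fixes-A) ,
    cancelʳ {a = Q} {c = P} QP≈I (P′ ⊗ N) ,
    M.sym (M.trans (⊗-congˡ Q′ (M.assoc P′ N Q)) (cancelˡ {a = Q′} {c = P′} Q′P′≈I (N ⊗ Q))) ,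
    refl
    where
    g-fixes-A : P′ ⊗ N ⊗ Q ⊗ A ⊗ N ᵀ ≈M A
    g-fixes-A = begin
      P′ ⊗ N ⊗ Q ⊗ A ⊗ N ᵀ      ≈⟨ solve 5 (λ p n q a m → (((p ⊕ n) ⊕ q) ⊕ a) ⊕ m ⊜ p ⊕ ((n ⊕ (q ⊕ a)) ⊕ m))
                                        M.refl P′ N Q A (N ᵀ) ⟩
      P′ ⊗ (N ⊗ (Q ⊗ A) ⊗ N ᵀ)  ≈⟨ ⊗-congˡ P′ Q′A≈NQANᵀ ⟨
      P′ ⊗ (Q′ ⊗ A)             ≈⟨ cancelˡ {a = P′} {c = Q′} P′Q′≈I A ⟩
      A                         ∎

  symmetricOf-preserves-even : ∀ g τ τ′ → OddInvolution τ → OddInvolution τ′ → parity A g ≡ false →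
                               g ∙ τ ≈ τ′ ∙ g → SHEquiv (symmetricOf τ) (symmetricOf τ′)
  symmetricOf-preserves-even (telem L R _ , _ , mR , LARᵀ≈A) (telem P Q _ , _) (telem P′ Q′ _ , _)
                             (refl , _) (refl , _) refl (_ , RQ≈Q′L , _) = R , mR , (begin
    Q′ ⊗ A                 ≈⟨ ⊗-congˡ Q′ LARᵀ≈A ⟨
    Q′ ⊗ (L ⊗ A ⊗ R ᵀ)     ≈⟨ solve 4 (λ q l a r → q ⊕ ((l ⊕ a) ⊕ r) ⊜ ((q ⊕ l) ⊕ a) ⊕ r) M.refl Q′ L A (R ᵀ) ⟩
    Q′ ⊗ L ⊗ A ⊗ R ᵀ       ≈⟨ ⊗-congʳ (R ᵀ) (⊗-congʳ A RQ≈Q′L) ⟨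
    R ⊗ Q ⊗ A ⊗ R ᵀ        ≈⟨ ⊗-congʳ (R ᵀ) (M.assoc R Q A) ⟩
    R ⊗ (Q ⊗ A) ⊗ R ᵀ      ∎)

  symmetricOf-preserves : ∀ τ τ′ → OddInvolution τ → OddInvolution τ′ → Conjugate τ τ′ →
                          SHEquiv (symmetricOf τ) (symmetricOf τ′)
  symmetricOf-preserves τ τ′ τ-odd τ′-odd τ~τ′ =
    let g , g-even , gτ≈τ′g = conjugate-by-even {τ} {τ′} τ-odd τ~τ′
    in symmetricOf-preserves-even g τ τ′ τ-odd τ′-odd g-even gτ≈τ′g

  SymIn-normalForm : ∀ {B} → SymIn A B → ∃ λ Q → IsMonomial Q × IsSymmetricMat (Q ⊗ A) × SHEquiv B (Q ⊗ A)
  SymIn-normalForm {B} ((L , R , mL , mR , B≈LARᵀ) , Bᵀ≈B) =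
    R ᵀ ⊗ L , monomial-⊗ (monomial-ᵀ mR) mL , SHEquiv-symmetric Bᵀ≈B B~RᵀLA , B~RᵀLA
    where
    B~RᵀLA : SHEquiv B (R ᵀ ⊗ L ⊗ A)
    B~RᵀLA = R ᵀ , monomial-ᵀ mR , M.sym (begin
      R ᵀ ⊗ B ⊗ R                ≈⟨ ⊗-congʳ R (⊗-congˡ (R ᵀ) B≈LARᵀ) ⟩
      R ᵀ ⊗ (L ⊗ A ⊗ R ᵀ) ⊗ R    ≈⟨ solve 4 (λ r l a s → (r ⊕ ((l ⊕ a) ⊕ r)) ⊕ s ⊜ ((r ⊕ l) ⊕ a) ⊕ (r ⊕ s))
                                       M.refl (R ᵀ) L A R ⟩
      R ᵀ ⊗ L ⊗ A ⊗ (R ᵀ ⊗ R)    ≈⟨ elimʳ {a = R ᵀ ⊗ R} (monomial-inverseˡ mR) (R ᵀ ⊗ L ⊗ A) ⟩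
      R ᵀ ⊗ L ⊗ A                ∎)

  oddInvolution-of-symmetric : ∀ {Q} → IsMonomial Q → IsSymmetricMat (Q ⊗ A) →
                               ∃ λ τ → OddInvolution τ × symmetricOf τ ≡ Q ⊗ A
  oddInvolution-of-symmetric {Q} mQ QAᵀ≈QA =
    (telem (Q ᵀ) Q true , monomial-ᵀ mQ , mQ , τ-fixes-A) ,
    (refl , monomial-inverseˡ mQ , monomial-inverseʳ mQ , refl) ,
    refl
    where
    τ-fixes-A : Q ᵀ ⊗ A ᵀ ⊗ Q ᵀ ≈M A
    τ-fixes-A = begin
      Q ᵀ ⊗ A ᵀ ⊗ Q ᵀ      ≈⟨ M.assoc (Q ᵀ) (A ᵀ) (Q ᵀ) ⟩
      Q ᵀ ⊗ (A ᵀ ⊗ Q ᵀ)    ≈⟨ ⊗-congˡ (Q ᵀ) (⊗-ᵀ Q A) ⟨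
      Q ᵀ ⊗ (Q ⊗ A) ᵀ      ≈⟨ ⊗-congˡ (Q ᵀ) QAᵀ≈QA ⟩
      Q ᵀ ⊗ (Q ⊗ A)        ≈⟨ cancelˡ {a = Q ᵀ} {c = Q} (monomial-inverseˡ mQ) A ⟩
      A                    ∎

  symmetricOf-onto : ∀ {B} → SymIn A B → ∃ λ τ → OddInvolution τ × SHEquiv B (symmetricOf τ)
  symmetricOf-onto B-sym =
    let Q , mQ , QA-sym , B~QA = SymIn-normalForm B-sym
        τ , τ-odd , τ↦QA = oddInvolution-of-symmetric mQ QA-sym
    in τ , τ-odd , subst (SHEquiv _) (sym τ↦QA) B~QA

  correspondence : ClassCorrespondence (SymIn A) SHEquiv OddInvolution Conjugate
  correspondence = record
    { image           = symmetricOf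
    ; image-P         = symmetricOf-SymIn
    ; image-preserves = symmetricOf-preserves
    ; image-reflects  = symmetricOf-reflects
    ; image-onto      = symmetricOf-onto
    }

  fromSplittingClasses : ∀ {h} → NumClasses (Splitting A) (ConjT A) h → NumClasses OddInvolution Conjugate h
  fromSplittingClasses (τ , τ-splitting , τ-distinct , τ-cover) =
    (λ i → τ i , proj₁ (τ-splitting i)) ,
    (λ i → proj₂ (τ-splitting i)) ,
    (λ i j ((g , g∈TAut) , gτ≈τg) → τ-distinct i j (g , g∈TAut , gτ≈τg)) ,
    λ (σ , σ∈TAut) σ-odd →
      let i , g , g∈TAut , gσ≈τg = τ-cover σ (σ∈TAut , σ-odd)
      in i , (g , g∈TAut) , gσ≈τg

  even-commute : AutAbelian A → EvenCommutative
  even-commute abelian (telem L R _ , g∈Aut) (telem L′ R′ _ , h∈Aut) refl refl =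
    let LL′≈L′L , RR′≈R′R = abelian L R L′ R′ g∈Aut h∈Aut in LL′≈L′L , RR′≈R′R , refl

corollary5p6 : ∀ (n : ℕ) (A : Mat n) → IsWeighing A → ClassSymmetric A →
    (∀ (m h : ℕ) → NumClasses (SymIn A) SHEquiv m → NumClasses (Splitting A) (ConjT A) h →
      m ≡ 0 ⊎ m ≡ h)
    × (AutAbelian A → ∀ (m : ℕ) → NumClasses (SymIn A) SHEquiv m →
      m ≡ 0 ⊎ ∃ (λ (e : ℕ) → m ≡ 2 ^ e))
corollary5p6 n A _ _ =
  (λ m h symmetricClasses splittingClasses → inj₂ (NumClasses-unique Conjugate-isEquivalence
     (oddInvolutionClasses symmetricClasses) (fromSplittingClasses splittingClasses))) ,
  (λ abelian m symmetricClasses →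
     oddInvolutionClasses-powerOfTwo (even-commute abelian) m (oddInvolutionClasses symmetricClasses))
  where
  open SplittingCorrespondence A
  oddInvolutionClasses : ∀ {m} → NumClasses (SymIn A) SHEquiv m → NumClasses OddInvolution Conjugate m
  oddInvolutionClasses = NumClasses-transport SHEquiv-isEquivalence correspondence
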